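{- In the Duo-Halve algorithm, when a new edge is added to the matching so that the previous $e_1$ becomes $e_2$, that edge either goes from full to half or its endpoints' accept/reject statuses remain unchanged.
   Context: Online vertex cover (vertex-arrival): vertices of an unknown graph arrive one at a time with their edges to previously revealed vertices; the algorithm maintains a set of accepted vertices covering all revealed edges, and may late-accept or late-reject vertices. Duo-Halve algorithm: it maintains a matching $M$ built incrementally (edges never removed); $V_M$ denotes the saturated vertices; vertices outside $V_M$ are always rejected. $e_1,e_2$ denote the most recently and second most recently added matching edges; a matching edge is full if both endpoints are accepted, half otherwise. When a new vertex $v$ arrives: if $v$ has a neighbor $p\notin V_M$ (chosen arbitrarily), $(p,v)$ is added to $M$, the old $e_1$ becomes $e_2$ and $(p,v)$ becomes $e_1$. Then every rejected vertex of $V_M$ adjacent to $v$ not an endpoint of $e_1,e_2$ is late-accepted, and HalveBoth chooses statuses of the endpoints of $e_1,e_2$ among those yielding a valid vertex cover, minimizing the number of accepted endpoints of $e_1,e_2$, with ties broken in favour of accepting fewer endpoints of $e_1$ and then fewer late operations. -}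

module Defs where

open import Data.Nat using (ℕ; zero; suc; _<_; _≤_; _≡ᵇ_; _<ᵇ_)
open import Data.Bool using (Bool; true; false; _∨_; _∧_; not; _xor_)
open import Data.List using (List; []; _∷_; take)
open import Data.Product using (_×_; _,_; proj₁; proj₂)
open import Data.Sum using (_⊎_)
open import Relation.Nullary using (¬_)
open import Relation.Binary.PropositionalEquality using (_≡_)

-- Vertices are natural numbers; vertex i is the (i+1)-th to arrive.
-- A graph is a symmetric irreflexive Boolean adjacency relation on ℕ;
-- when vertex v arrives, the edges to previously revealed vertices u < v
-- are revealed.
Graph : Set
Graph = ℕ → ℕ → Bool

Edge : Set
Edge = ℕ × ℕ

-- Matching as a list of edges, most recently added first
-- (so e₁ = head, e₂ = second element).  Edges are never removed.
Matching : Set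
Matching = List Edge

-- Status: true = accepted, false = rejected.
Status : Set
Status = ℕ → Bool

occurs : ℕ → List ℕ → Bool
occurs u []       = false
occurs u (x ∷ xs) = (u ≡ᵇ x) ∨ occurs u xs

vertsOf : List Edge → List ℕ
vertsOf []              = []
vertsOf ((a , b) ∷ es)  = a ∷ b ∷ vertsOf es

_∈V_ : ℕ → Matching → Set
u ∈V M = occurs u (vertsOf M) ≡ true

e1Ends : Matching → List ℕ
e1Ends M = vertsOf (take 1 M)

duoEnds : Matching → List ℕ
duoEnds M = vertsOf (take 2 M)

countTrue : Status → List ℕ → ℕ
countTrue f []       = 0
countTrue f (x ∷ xs) with f x
... | true  = suc (countTrue f xs)
... | false = countTrue f xs

lateOps : ℕ → Status → Status → List ℕ → ℕ
lateOps v old new []       = 0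
lateOps v old new (x ∷ xs) with (x <ᵇ v) ∧ (old x xor new x)
... | true  = suc (lateOps v old new xs)
... | false = lateOps v old new xs

IsCover : Graph → ℕ → Status → Set
IsCover G v acc = ∀ a b → a ≤ v → b ≤ v → G a b ≡ true → acc a ≡ true ⊎ acc b ≡ true

data NewMatching (G : Graph) (v : ℕ) (M : Matching) : Matching → Set where
  add  : (p : ℕ) → p < v → G p v ≡ true → ¬ (p ∈V M) →
         NewMatching G v M ((p , v) ∷ M)
  keep : (∀ p → p < v → G p v ≡ true → p ∈V M) →
         NewMatching G v M M

-- Step 2: late-accept every rejected vertex of V_M adjacent to v that is
-- not an endpoint of e₁, e₂ (M is the already updated matching).
lateAccept : Graph → ℕ → Matching → Status → Status
lateAccept G v M acc u =
  acc u ∨ (occurs u (vertsOf M) ∧ (u <ᵇ v) ∧ G u v ∧ not (occurs u (duoEnds M)))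

LexLeq : ℕ × ℕ × ℕ → ℕ × ℕ × ℕ → Set
LexLeq (a₁ , b₁ , c₁) (a₂ , b₂ , c₂) =
  a₁ < a₂ ⊎ (a₁ ≡ a₂ × (b₁ < b₂ ⊎ (b₁ ≡ b₂ × c₁ ≤ c₂)))

cost : ℕ → Matching → Status → Status → ℕ × ℕ × ℕ
cost v M old new =
  countTrue new (duoEnds M) , countTrue new (e1Ends M) , lateOps v old new (duoEnds M)

Candidate : Graph → ℕ → Matching → Status → Status → Set
Candidate G v M mid new =
  (∀ u → occurs u (duoEnds M) ≡ false → new u ≡ mid u) × IsCover G v new

-- Step 3: HalveBoth (old = statuses before the arrival of v,
-- mid = statuses after the late-accepts of step 2)
record HalveBoth (G : Graph) (v : ℕ) (M : Matching) (old mid new : Status) : Set where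
  field
    candidate : Candidate G v M mid new
    optimal   : ∀ new′ → Candidate G v M mid new′ →
                LexLeq (cost v M old new) (cost v M old new′)

record State : Set where
  constructor st
  field
    revealed : ℕ          -- number of revealed vertices = next vertex
    matching : Matching
    status   : Status

open State public

data Step (G : Graph) : State → State → Set where
  step : ∀ {v M acc M′ acc′} →
         NewMatching G v M M′ →
         HalveBoth G v M′ acc (lateAccept G v M′ acc) acc′ →
         Step G (st v M acc) (st (suc v) M′ acc′)

initial : State
initial = st 0 [] (λ _ → false)

data Reachable (G : Graph) : State → Set where
  init : Reachable G initial
  next : ∀ {s s′} → Reachable G s → Step G s s′ → Reachable G s′

Full : Status → Edge → Set
Full acc (a , b) = acc a ≡ true × acc b ≡ true

Half : Status → Edge → Set
Half acc e = ¬ Full acc e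

-- Let (p , v) be the new matching edge and (a , b) the old e₁.  If (a , b) is
-- full, it either stays full, hence unchanged, or becomes half.  If it is half,
-- exactly one of a, b is accepted since the edge is covered.  Accepting v on top
-- of the late-accepts is then a HalveBoth candidate of cost (2, 1, 0), because p,
-- unmatched before v arrived, is rejected.  Every candidate covers both (p , v)
-- and (a , b), so its cost is at least (2, 1, _); hence the chosen statuses make
-- no late operation on the endpoints of e₁ and e₂, in particular none on a, b.
module Submission where

open import Defs
open import Data.Nat using (ℕ; suc; _+_; _<_; _≤_; _≡ᵇ_; _<ᵇ_; z≤n; s≤s)
open import Data.Nat.Properties
  using (≡ᵇ⇒≡; ≡⇒≡ᵇ; <ᵇ⇒<; <⇒<ᵇ; n≤0⇒n≡0; <⇒≢; ≤∧≢⇒<; <⇒≤; ≤-refl;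
         n<1+n; m<n⇒m<1+n; +-mono-≤; <⇒≱; _≟_; module ≤-Reasoning)
open import Data.Bool using (true; false; _∨_; _∧_; _xor_)
open import Data.Bool.Properties
  using (T-≡; ¬-not; not-¬; ∨-identityʳ; ∨-zeroʳ; ∧-zeroʳ; xor-same)
  renaming (_≟_ to _≟ᵇ_)
open import Data.Empty using (⊥-elim)
open import Data.List using ([]; _∷_; _++_; take)
open import Data.List.Membership.Propositional using (_∈_; _∉_)
open import Data.List.Relation.Unary.Any using (here; there)
open import Data.List.Relation.Unary.All using (All; []; _∷_; tabulate)
open import Data.Product using (_×_; _,_; proj₁; proj₂)
open import Data.Sum using (_⊎_; inj₁; inj₂)
open import Function.Bundles using (Equivalence)
open import Relation.Nullary using (Dec; yes; no)
open import Relation.Nullary.Decidable using (_×-dec_)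
open import Relation.Binary.PropositionalEquality
  using (_≡_; _≢_; refl; sym; trans; cong; cong₂; subst; module ≡-Reasoning)

≡ᵇ-refl : ∀ n → (n ≡ᵇ n) ≡ true
≡ᵇ-refl n = Equivalence.to T-≡ (≡⇒≡ᵇ n n refl)

≢⇒≡ᵇ≡false : ∀ {m n} → m ≢ n → (m ≡ᵇ n) ≡ false
≢⇒≡ᵇ≡false {m} {n} m≢n = ¬-not (λ eq → m≢n (≡ᵇ⇒≡ m n (Equivalence.from T-≡ eq)))

<⇒<ᵇ≡true : ∀ {m n} → m < n → (m <ᵇ n) ≡ true
<⇒<ᵇ≡true m<n = Equivalence.to T-≡ (<⇒<ᵇ m<n)

xor≡false⇒≡ : ∀ x y → x xor y ≡ false → y ≡ x
xor≡false⇒≡ true  true  _ = refl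
xor≡false⇒≡ false false _ = refl

∈⇒occurs : ∀ {u xs} → u ∈ xs → occurs u xs ≡ true
∈⇒occurs {u} (here refl) rewrite ≡ᵇ-refl u = refl
∈⇒occurs {u} {x ∷ _} (there u∈xs) rewrite ∈⇒occurs u∈xs = ∨-zeroʳ (u ≡ᵇ x)

occurs⇒∈ : ∀ {u xs} → occurs u xs ≡ true → u ∈ xs
occurs⇒∈ {u} {x ∷ xs} h with u ≡ᵇ x in eq
... | true  = here (≡ᵇ⇒≡ u x (Equivalence.from T-≡ eq))
... | false = there (occurs⇒∈ h)

∉⇒occurs≡false : ∀ {u xs} → u ∉ xs → occurs u xs ≡ false
∉⇒occurs≡false u∉xs = ¬-not (λ h → u∉xs (occurs⇒∈ h))

vertsOf-take⊆ : ∀ n M {u} → u ∈ vertsOf (take n M) → u ∈ vertsOf M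
vertsOf-take⊆ (suc n) (_ ∷ _) (here refl)                = here refl
vertsOf-take⊆ (suc n) (_ ∷ _) (there (here refl))        = there (here refl)
vertsOf-take⊆ (suc n) (_ ∷ M) (there (there u∈))          = there (there (vertsOf-take⊆ n M u∈))

countTrue-++ : ∀ f xs ys → countTrue f (xs ++ ys) ≡ countTrue f xs + countTrue f ys
countTrue-++ f []       ys = refl
countTrue-++ f (x ∷ xs) ys with f x
... | true  = cong suc (countTrue-++ f xs ys)
... | false = countTrue-++ f xs ys

countTrue-cong : ∀ {f g xs} → All (λ x → f x ≡ g x) xs → countTrue f xs ≡ countTrue g xs
countTrue-cong []                            = refl
countTrue-cong {g = g} {x ∷ _} (fx≡gx ∷ rest) rewrite fx≡gx with g x
... | true  = cong suc (countTrue-cong rest)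
... | false = countTrue-cong rest

countTrue-covered-pair : ∀ {f x y} → f x ≡ true ⊎ f y ≡ true → 1 ≤ countTrue f (x ∷ y ∷ [])
countTrue-covered-pair (inj₁ fx) rewrite fx = s≤s z≤n
countTrue-covered-pair {f} {x} (inj₂ fy) with f x
... | true  = s≤s z≤n
... | false rewrite fy = s≤s z≤n

countTrue-half-pair : ∀ {f x y} → Half f (x , y) → f x ≡ true ⊎ f y ≡ true →
                      countTrue f (x ∷ y ∷ []) ≡ 1
countTrue-half-pair {f} {x} {y} half cov with f x | f y in fy
... | true  | true  = ⊥-elim (half (refl , refl))
... | true  | false rewrite fy = refl
... | false | true  rewrite fy = refl
... | false | false with cov
...   | inj₁ ()
...   | inj₂ ()

lateOps≡0⇒unchanged : ∀ {v old new} xs → lateOps v old new xs ≡ 0 →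
                      All (λ x → x < v → new x ≡ old x) xs
lateOps≡0⇒unchanged [] _ = []
lateOps≡0⇒unchanged {v} {old} {new} (x ∷ xs) h
  with (x <ᵇ v) ∧ (old x xor new x) in noOp
... | false = unchanged ∷ lateOps≡0⇒unchanged xs h
  where
  unchanged : x < v → new x ≡ old x
  unchanged x<v = xor≡false⇒≡ (old x) (new x)
    (subst (λ b → b ∧ (old x xor new x) ≡ false) (<⇒<ᵇ≡true x<v) noOp)

unchanged⇒lateOps≡0 : ∀ {v old new xs} → All (λ x → x < v → new x ≡ old x) xs →
                      lateOps v old new xs ≡ 0
unchanged⇒lateOps≡0 [] = refl
unchanged⇒lateOps≡0 {v} {old} {xs = x ∷ _} (unchanged ∷ rest) with x <ᵇ v in x<ᵇv
... | false = unchanged⇒lateOps≡0 rest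
... | true rewrite unchanged (<ᵇ⇒< x v (Equivalence.from T-≡ x<ᵇv)) | xor-same (old x) =
  unchanged⇒lateOps≡0 rest

LexLeq⇒third≤ : ∀ {x₁ x₂ x₃ y₁ y₂ y₃} → LexLeq (x₁ , x₂ , x₃) (y₁ , y₂ , y₃) →
                y₁ ≤ x₁ → y₂ ≤ x₂ → x₃ ≤ y₃
LexLeq⇒third≤ (inj₁ x₁<y₁)                    y₁≤x₁ _     = ⊥-elim (<⇒≱ x₁<y₁ y₁≤x₁)
LexLeq⇒third≤ (inj₂ (refl , inj₁ x₂<y₂))      _     y₂≤x₂ = ⊥-elim (<⇒≱ x₂<y₂ y₂≤x₂)
LexLeq⇒third≤ (inj₂ (refl , inj₂ (refl , le))) _     _     = le

lateAccept-monotone : ∀ G v M acc {u} → acc u ≡ true → lateAccept G v M acc u ≡ true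
lateAccept-monotone G v M acc accu rewrite accu = refl

lateAccept-unmatched : ∀ G v M acc {u} → u ∉ vertsOf M → lateAccept G v M acc u ≡ acc u
lateAccept-unmatched G v M acc {u} u∉ rewrite ∉⇒occurs≡false u∉ = ∨-identityʳ (acc u)

lateAccept-duoEnds : ∀ G v M acc {u} → u ∈ duoEnds M → lateAccept G v M acc u ≡ acc u
lateAccept-duoEnds G v M acc {u} u∈ rewrite ∈⇒occurs u∈
  | ∧-zeroʳ (G u v) | ∧-zeroʳ (u <ᵇ v) | ∧-zeroʳ (occurs u (vertsOf M)) = ∨-identityʳ (acc u)

acceptVertex : ℕ → Status → Status
acceptVertex v f u = f u ∨ (u ≡ᵇ v)

acceptVertex-self : ∀ v f → acceptVertex v f v ≡ true
acceptVertex-self v f rewrite ≡ᵇ-refl v = ∨-zeroʳ (f v)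

acceptVertex-other : ∀ {v u} f → u ≢ v → acceptVertex v f u ≡ f u
acceptVertex-other f u≢v rewrite ≢⇒≡ᵇ≡false u≢v = ∨-identityʳ _

acceptVertex-monotone : ∀ v f {u} → f u ≡ true → acceptVertex v f u ≡ true
acceptVertex-monotone v f fu rewrite fu = refl

halveBoth-noLateOps : ∀ {G v M old mid new alt} → HalveBoth G v M old mid new →
  Candidate G v M mid alt →
  countTrue alt (duoEnds M) ≤ countTrue new (duoEnds M) →
  countTrue alt (e1Ends M) ≤ countTrue new (e1Ends M) →
  lateOps v old alt (duoEnds M) ≡ 0 → lateOps v old new (duoEnds M) ≡ 0
halveBoth-noLateOps hb altCandidate duo≤ e1≤ noOps =
  n≤0⇒n≡0 (subst (_ ≤_) noOps
    (LexLeq⇒third≤ (HalveBoth.optimal hb _ altCandidate) duo≤ e1≤))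

CoversBelow : Graph → ℕ → Status → Set
CoversBelow G v acc =
  ∀ x y → x < v → y < v → G x y ≡ true → acc x ≡ true ⊎ acc y ≡ true

module AcceptNewVertex (G : Graph) (v : ℕ) (M : Matching) (acc : Status) where

  mid alt : Status
  mid = lateAccept G v M acc
  alt = acceptVertex v mid

  alt-revealedDuo : ∀ {u} → u ∈ duoEnds M → u < v → alt u ≡ acc u
  alt-revealedDuo u∈ u<v =
    trans (acceptVertex-other mid (<⇒≢ u<v)) (lateAccept-duoEnds G v M acc u∈)

  alt-noLateOps : lateOps v acc alt (duoEnds M) ≡ 0
  alt-noLateOps = unchanged⇒lateOps≡0 {new = alt} (tabulate alt-revealedDuo)

  alt-isCover : CoversBelow G v acc → IsCover G v alt
  alt-isCover covers x y x≤v y≤v gxy with x ≟ v | y ≟ v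
  ... | yes refl | _        = inj₁ (acceptVertex-self v mid)
  ... | no _     | yes refl = inj₂ (acceptVertex-self v mid)
  ... | no x≢v   | no y≢v   with covers x y (≤∧≢⇒< x≤v x≢v) (≤∧≢⇒< y≤v y≢v) gxy
  ...   | inj₁ accx = inj₁ (acceptVertex-monotone v mid (lateAccept-monotone G v M acc accx))
  ...   | inj₂ accy = inj₂ (acceptVertex-monotone v mid (lateAccept-monotone G v M acc accy))

  alt-isCandidate : CoversBelow G v acc → v ∈ duoEnds M → Candidate G v M mid alt
  alt-isCandidate covers v∈ =
      (λ u u∉ → acceptVertex-other mid (λ { refl → not-¬ u∉ (∈⇒occurs v∈) }))
    , alt-isCover covers

halveBoth-keepsHalfE₂ : ∀ {G v acc acc′ p a b rest} →
  let M′ = (p , v) ∷ (a , b) ∷ rest in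
  HalveBoth G v M′ acc (lateAccept G v M′ acc) acc′ →
  CoversBelow G v acc → acc p ≡ false →
  p < v → G p v ≡ true → a < v → b < v → G a b ≡ true →
  countTrue acc (a ∷ b ∷ []) ≡ 1 →
  acc′ a ≡ acc a × acc′ b ≡ acc b
halveBoth-keepsHalfE₂ {G} {v} {acc} {acc′} {p} {a} {b} {rest}
  hb covers accp≡false p<v gpv a<v b<v gab oneAccepted
  with lateOps≡0⇒unchanged (p ∷ v ∷ a ∷ b ∷ [])
         (halveBoth-noLateOps hb (alt-isCandidate covers (there (here refl))) duo≤ e₁≤ alt-noLateOps)
  where
  open AcceptNewVertex G v ((p , v) ∷ (a , b) ∷ rest) acc

  alt-e₁ : countTrue alt (p ∷ v ∷ []) ≡ 1
  alt-e₁ = countTrue-half-pair {f = alt}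
    (λ full → not-¬ (trans (alt-revealedDuo (here refl) p<v) accp≡false) (proj₁ full))
    (inj₂ (acceptVertex-self v mid))

  alt-e₂ : countTrue alt (a ∷ b ∷ []) ≡ 1
  alt-e₂ = trans (countTrue-cong {f = alt} ( alt-revealedDuo (there (there (here refl))) a<v
                                           ∷ alt-revealedDuo (there (there (there (here refl)))) b<v
                                           ∷ []))
                 oneAccepted

  acc′-covers : ∀ {x y} → x ≤ v → y ≤ v → G x y ≡ true → acc′ x ≡ true ⊎ acc′ y ≡ true
  acc′-covers = proj₂ (HalveBoth.candidate hb) _ _

  pv-covered : 1 ≤ countTrue acc′ (p ∷ v ∷ [])
  pv-covered = countTrue-covered-pair {f = acc′} (acc′-covers (<⇒≤ p<v) ≤-refl gpv)

  ab-covered : 1 ≤ countTrue acc′ (a ∷ b ∷ [])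
  ab-covered = countTrue-covered-pair {f = acc′} (acc′-covers (<⇒≤ a<v) (<⇒≤ b<v) gab)

  e₁≤ : countTrue alt (p ∷ v ∷ []) ≤ countTrue acc′ (p ∷ v ∷ [])
  e₁≤ = subst (_≤ _) (sym alt-e₁) pv-covered

  duo≤ : countTrue alt (p ∷ v ∷ a ∷ b ∷ []) ≤ countTrue acc′ (p ∷ v ∷ a ∷ b ∷ [])
  duo≤ = begin
    countTrue alt (p ∷ v ∷ a ∷ b ∷ [])                         ≡⟨ countTrue-++ alt (p ∷ v ∷ []) (a ∷ b ∷ []) ⟩
    countTrue alt (p ∷ v ∷ []) + countTrue alt (a ∷ b ∷ [])     ≡⟨ cong₂ _+_ alt-e₁ alt-e₂ ⟩
    1 + 1                                                      ≤⟨ +-mono-≤ pv-covered ab-covered ⟩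
    countTrue acc′ (p ∷ v ∷ []) + countTrue acc′ (a ∷ b ∷ [])   ≡⟨ countTrue-++ acc′ (p ∷ v ∷ []) (a ∷ b ∷ []) ⟨
    countTrue acc′ (p ∷ v ∷ a ∷ b ∷ [])                        ∎
    where open ≤-Reasoning
... | _ ∷ _ ∷ unchanged-a ∷ unchanged-b ∷ [] = unchanged-a a<v , unchanged-b b<v

record Invariant (G : Graph) (s : State) : Set where
  field
    coversRevealed    : CoversBelow G (revealed s) (status s)
    unmatchedRejected : ∀ {u} → u ∉ vertsOf (matching s) → status s u ≡ false
    matchedRevealed   : ∀ {u} → u ∈ vertsOf (matching s) → u < revealed s
    lastMatchedIsEdge : ∀ {a b rest} → matching s ≡ (a , b) ∷ rest → G a b ≡ true

newMatching-⊇ : ∀ {G v M M′} → NewMatching G v M M′ →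
                ∀ {u} → u ∈ vertsOf M → u ∈ vertsOf M′
newMatching-⊇ (add _ _ _ _) u∈ = there (there u∈)
newMatching-⊇ (keep _)      u∈ = u∈

newMatching-revealed : ∀ {G v M M′} → NewMatching G v M M′ →
  (∀ {u} → u ∈ vertsOf M → u < v) → ∀ {u} → u ∈ vertsOf M′ → u < suc v
newMatching-revealed (add _ p<v _ _) _   (here refl)         = m<n⇒m<1+n p<v
newMatching-revealed (add _ _ _ _)   _   (there (here refl)) = n<1+n _
newMatching-revealed (add _ _ _ _)   old (there (there u∈))  = m<n⇒m<1+n (old u∈)
newMatching-revealed (keep _)        old u∈                  = m<n⇒m<1+n (old u∈)

newMatching-lastIsEdge : ∀ {G v M M′} → NewMatching G v M M′ →
  (∀ {a b rest} → M ≡ (a , b) ∷ rest → G a b ≡ true) →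
  ∀ {a b rest} → M′ ≡ (a , b) ∷ rest → G a b ≡ true
newMatching-lastIsEdge (add _ _ gpv _) _   refl = gpv
newMatching-lastIsEdge (keep _)        old eq   = old eq

step-preserves-Invariant : ∀ {G s s′} → Invariant G s → Step G s s′ → Invariant G s′
step-preserves-Invariant {G} inv (step {v} {M} {acc} {M′} {acc′} nm hb) = record
  { coversRevealed    = λ { x y (s≤s x≤v) (s≤s y≤v) → proj₂ (HalveBoth.candidate hb) x y x≤v y≤v }
  ; unmatchedRejected = unmatchedRejected′
  ; matchedRevealed   = newMatching-revealed nm matchedRevealed
  ; lastMatchedIsEdge = newMatching-lastIsEdge nm lastMatchedIsEdge
  }
  where
  open Invariant inv
  unmatchedRejected′ : ∀ {u} → u ∉ vertsOf M′ → acc′ u ≡ false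
  unmatchedRejected′ {u} u∉M′ = begin
    acc′ u                      ≡⟨ proj₁ (HalveBoth.candidate hb) u
                                     (∉⇒occurs≡false (λ u∈ → u∉M′ (vertsOf-take⊆ 2 M′ u∈))) ⟩
    lateAccept G v M′ acc u     ≡⟨ lateAccept-unmatched G v M′ acc u∉M′ ⟩
    acc u                       ≡⟨ unmatchedRejected (λ u∈M → u∉M′ (newMatching-⊇ nm u∈M)) ⟩
    false                       ∎
    where open ≡-Reasoning

reachable⇒Invariant : ∀ {G s} → Reachable G s → Invariant G s
reachable⇒Invariant init = record
  { coversRevealed    = λ _ _ ()
  ; unmatchedRejected = λ _ → refl
  ; matchedRevealed   = λ ()
  ; lastMatchedIsEdge = λ ()
  }
reachable⇒Invariant (next r s) = step-preserves-Invariant (reachable⇒Invariant r) s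

Full? : ∀ acc e → Dec (Full acc e)
Full? acc (a , b) = (acc a ≟ᵇ true) ×-dec (acc b ≟ᵇ true)

fullToHalf-or-unchanged : ∀ (acc acc′ : Status) e →
  (Half acc e → acc′ (proj₁ e) ≡ acc (proj₁ e) × acc′ (proj₂ e) ≡ acc (proj₂ e)) →
  (Full acc e × Half acc′ e) ⊎ (acc′ (proj₁ e) ≡ acc (proj₁ e) × acc′ (proj₂ e) ≡ acc (proj₂ e))
fullToHalf-or-unchanged acc acc′ e halfKept with Full? acc e | Full? acc′ e
... | yes (a , b) | yes (a′ , b′) = inj₂ (trans a′ (sym a) , trans b′ (sym b))
... | yes full    | no half′      = inj₁ (full , half′)
... | no half     | _             = inj₂ (halfKept half)

mainTheorem14 : (G : Graph) → (∀ a b → G a b ≡ G b a) → (∀ a → G a a ≡ false) →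
    ∀ {s s′} → Reachable G s → Step G s s′ →
    ∀ (p : ℕ) (e : Edge) rest →
    matching s ≡ e ∷ rest →
    matching s′ ≡ (p , revealed s) ∷ matching s →
    (Full (status s) e × Half (status s′) e)
      ⊎ (status s′ (proj₁ e) ≡ status s (proj₁ e)
         × status s′ (proj₂ e) ≡ status s (proj₂ e))
mainTheorem14 G _ _ r (step (keep _) hb) p e rest refl ()
mainTheorem14 G _ _ r (step {acc = acc} {acc′ = acc′} (add p p<v gpv p∉M) hb) .p (a , b) rest refl refl =
  fullToHalf-or-unchanged acc acc′ (a , b) λ half →
    halveBoth-keepsHalfE₂ hb coversRevealed (unmatchedRejected (λ p∈M → p∉M (∈⇒occurs p∈M)))
      p<v gpv a<v b<v gab (countTrue-half-pair {f = acc} half (coversRevealed a b a<v b<v gab))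
  where
  open Invariant (reachable⇒Invariant r)
  a<v : a < _
  a<v = matchedRevealed (here refl)
  b<v : b < _
  b<v = matchedRevealed (there (here refl))
  gab : G a b ≡ true
  gab = lastMatchedIsEdge refl
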